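{- Let $\Gamma$ be a branching diagram and let $t=(v_0,v_1,v_2,\dots)$ be an infinite path in $\Gamma$ ($v_0=\varnothing$, $v_n\in\Gamma_n$, $v_{n-1}\nearrow v_n$). For $u\in\Gamma$ put $d(u,t)=\lim_{n\to\infty}d(u,v_n)$ (the sequence is weakly increasing). The following are equivalent: (i) all but finitely many vertices $v_n$ of $t$ have exactly one immediate predecessor (namely $v_{n-1}$); (ii) $d(\varnothing,t)<\infty$; (iii) $d(u,t)<\infty$ for all $u\in\Gamma$; (iv) there are only finitely many infinite paths starting at $\varnothing$ which eventually coincide with $t$.
   Context: A branching diagram is a graded poset $\Gamma=\bigsqcup_{n\ge0}\Gamma_n$ with each $\Gamma_n$ finite, a unique minimal element $\varnothing\in\Gamma_0$, and no maximal elements; $u\nearrow w$ denotes the covering relation (which raises rank by one). $d(u,v)$ is the number of saturated chains $u=x_0\nearrow x_1\nearrow\cdots\nearrow x_r=v$. -}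

module Defs where

open import Data.Nat using (ℕ; zero; suc; _+_; _*_; _≤_)
open import Data.Fin using (Fin)
open import Data.Fin.Properties using (_≟_)
open import Data.Bool using (Bool; true; false; if_then_else_)
open import Data.Vec using (sum; tabulate)
open import Data.Product using (Σ; ∃; _×_; _,_; proj₁; proj₂; Σ-syntax; ∃-syntax)
open import Data.List using (List)
open import Data.List.Relation.Unary.Any using (Any)
open import Relation.Binary.PropositionalEquality using (_≡_)
open import Relation.Nullary.Decidable using (⌊_⌋)

-- A branching diagram: level Γ_n is the finite set Fin (size n);
-- Γ_0 is a singleton {∅}; the covering relation u ↗ w (u ∈ Γ_n, w ∈ Γ_{n+1})
-- is the Bool-valued relation 'edge n u w'.
record BranchingDiagram : Set where
  field
    size    : ℕ → ℕ
    size-0  : size 0 ≡ 1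
    edge    : (n : ℕ) → Fin (size n) → Fin (size (suc n)) → Bool
    hasPred : (n : ℕ) (w : Fin (size (suc n))) → ∃[ u ] (edge n u w ≡ true)
    hasSucc : (n : ℕ) (u : Fin (size n)) → ∃[ w ] (edge n u w ≡ true)

HasFiniteLimit : (ℕ → ℕ) → Set
HasFiniteLimit f = ∃[ L ] ∃[ N ] (∀ n → N ≤ n → f n ≡ L)

module _ (Γ : BranchingDiagram) where
  open BranchingDiagram Γ

  -- d m u k v = d(u,v) = number of saturated chains from u ∈ Γ_m to v ∈ Γ_{k+m}
  d : (m : ℕ) → Fin (size m) → (k : ℕ) → Fin (size (k + m)) → ℕ
  d m u zero    v = if ⌊ u ≟ v ⌋ then 1 else 0
  d m u (suc k) w = sum (tabulate λ v → d m u k v * (if edge (k + m) v w then 1 else 0))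

  -- infinite paths v_0 ↗ v_1 ↗ ... (v_n ∈ Γ_n, so v_0 = ∅ automatically)
  Path : Set
  Path = Σ[ v ∈ ((n : ℕ) → Fin (size n)) ] (∀ n → edge n (v n) (v (suc n)) ≡ true)

  vert : Path → (n : ℕ) → Fin (size n)
  vert = proj₁

  EventuallyEq : Path → Path → Set
  EventuallyEq p q = ∃[ N ] (∀ n → N ≤ n → vert p n ≡ vert q n)

  -- d(u,t) < ∞ for u ∈ Γ_m : the weakly increasing sequence n ↦ d(u, v_n)
  -- (n = k + m ≥ m) has a finite limit
  dFinite : (m : ℕ) → Fin (size m) → Path → Set
  dFinite m u t = HasFiniteLimit (λ k → d m u k (vert t (k + m)))

  EventuallyUniquePred : Path → Set
  EventuallyUniquePred t =
    ∃[ N ] (∀ n → N ≤ n → ∀ u → edge n u (vert t (suc n)) ≡ true → u ≡ vert t n)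

  -- (iv) the set of infinite paths (from ∅) eventually coinciding with t is finite:
  -- it is enumerated by a finite list of its elements (paths compared pointwise)
  FinitelyManyCofinal : Path → Set
  FinitelyManyCofinal t =
    Σ[ L ∈ List (Σ[ q ∈ Path ] EventuallyEq q t) ]
      (∀ (p : Path) → EventuallyEq p t →
        Any (λ q → ∀ n → vert p n ≡ vert (proj₁ q) n) L)

{-# OPTIONS --safe #-}
module Submission where

-- Since d(u, v_{n+1}) is the sum of d(u, x) over the predecessors x of v_{n+1}, the
-- sequence d(u, v_n) is stationary at every step where v_{n+1} has the single predecessor
-- v_n, while at any other step it grows by at least d(∅, x) ≥ 1; this gives (i) ⇔ (ii) ⇔ (iii).
-- A second predecessor x of v_{n+1} yields a path that follows t above level n but passes
-- through x (complete it downwards by choosing predecessors), so infinitely many such n give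
-- infinitely many cofinal paths.  Conversely, once all predecessors are unique from level N on,
-- every cofinal path agrees with t from N on, and those paths are enumerated level by level,
-- choosing among the finitely many predecessors at each level below N.

open import Defs
open import Data.Nat using (ℕ; zero; suc; _+_; _*_; _∸_; _≤_; z≤n; _⊔_)
open import Data.Nat.Properties
open import Data.Fin using (Fin; zero; suc)
import Data.Fin.Properties as Fin
open import Data.Bool using (true; false; if_then_else_)
import Data.Bool.Properties as Bool
open import Data.Vec using (sum; tabulate)
open import Data.Product using (_×_; _,_; proj₁; proj₂; Σ-syntax; ∃-syntax)
open import Data.Sum using (inj₁; inj₂)
open import Data.List using (List; []; _∷_; [_]; map; concatMap; allFin)
open import Data.List.Relation.Unary.All as All using (All; []; _∷_)
open import Data.List.Relation.Unary.Any using (Any; here)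
import Data.List.Relation.Unary.Any.Properties as Any
open import Data.List.Membership.Propositional using (lose)
open import Data.List.Membership.Propositional.Properties using (∈-allFin)
open import Function.Base using (_∘_)
open import Relation.Nullary using (yes; no; contradiction)
open import Relation.Binary.PropositionalEquality hiding ([_])
open import Function.Bundles using (_⇔_; mk⇔)

sum-tabulate-zero : ∀ {n} (h : Fin n → ℕ) → (∀ i → h i ≡ 0) → sum (tabulate h) ≡ 0
sum-tabulate-zero {zero}  h h≡0 = refl
sum-tabulate-zero {suc n} h h≡0 =
  cong₂ _+_ (h≡0 zero) (sum-tabulate-zero (h ∘ suc) (h≡0 ∘ suc))

sum-tabulate-single : ∀ {n} (h : Fin n → ℕ) (j : Fin n) →
                      (∀ i → i ≢ j → h i ≡ 0) → sum (tabulate h) ≡ h j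
sum-tabulate-single h zero    h≡0 = begin
  h zero + sum (tabulate (h ∘ suc))
    ≡⟨ cong (h zero +_) (sum-tabulate-zero (h ∘ suc) (λ i → h≡0 (suc i) λ ())) ⟩
  h zero + 0
    ≡⟨ +-identityʳ (h zero) ⟩
  h zero
    ∎
  where open ≡-Reasoning
sum-tabulate-single h (suc j) h≡0 =
  cong₂ _+_ (h≡0 zero λ ())
    (sum-tabulate-single (h ∘ suc) j (λ i i≢j → h≡0 (suc i) (i≢j ∘ Fin.suc-injective)))

term≤sum-tabulate : ∀ {n} (h : Fin n → ℕ) (i : Fin n) → h i ≤ sum (tabulate h)
term≤sum-tabulate h zero    = m≤m+n _ _
term≤sum-tabulate h (suc i) = ≤-trans (term≤sum-tabulate (h ∘ suc) i) (m≤n+m _ _)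

two-terms≤sum-tabulate : ∀ {n} (h : Fin n → ℕ) {i j : Fin n} → i ≢ j →
                         h i + h j ≤ sum (tabulate h)
two-terms≤sum-tabulate h {zero}  {zero}  i≢j = contradiction refl i≢j
two-terms≤sum-tabulate h {zero}  {suc j} i≢j = +-monoʳ-≤ (h zero) (term≤sum-tabulate (h ∘ suc) j)
two-terms≤sum-tabulate h {suc i} {zero}  i≢j =
  subst (_≤ sum (tabulate h)) (+-comm (h zero) (h (suc i)))
    (+-monoʳ-≤ (h zero) (term≤sum-tabulate (h ∘ suc) i))
two-terms≤sum-tabulate h {suc i} {suc j} i≢j =
  ≤-trans (two-terms≤sum-tabulate (h ∘ suc) (i≢j ∘ cong suc)) (m≤n+m _ _)

Fin-singleton : ∀ {n} → n ≡ 1 → (i j : Fin n) → i ≡ j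
Fin-singleton refl zero zero = refl

*-indicator-true : ∀ a {b} → b ≡ true → a * (if b then 1 else 0) ≡ a
*-indicator-true a refl = *-identityʳ a

*-indicator-false : ∀ a {b} → b ≡ false → a * (if b then 1 else 0) ≡ 0
*-indicator-false a refl = *-zeroʳ a

stationary⇒hasFiniteLimit : (f : ℕ → ℕ) (N : ℕ) →
                            (∀ k → N ≤ k → f (suc k) ≡ f k) → HasFiniteLimit f
stationary⇒hasFiniteLimit f N stat = f N , N , λ n N≤n →
  trans (cong f (sym (m∸n+n≡m N≤n))) (constant (n ∸ N))
  where
  constant : ∀ j → f (j + N) ≡ f N
  constant zero    = refl
  constant (suc j) = trans (stat (j + N) (m≤n+m N j)) (constant j)

module Sequences {a} (F : ℕ → Set a) where

  AgreesFrom : ℕ → ((k : ℕ) → F k) → ((k : ℕ) → F k) → Set a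
  AgreesFrom n f g = ∀ k → n ≤ k → f k ≡ g k

  agreesFrom-mono : ∀ {m n f g} → m ≤ n → AgreesFrom m f g → AgreesFrom n f g
  agreesFrom-mono m≤n agree k n≤k = agree k (≤-trans m≤n n≤k)

  update : (n : ℕ) → F n → ((k : ℕ) → F k) → (k : ℕ) → F k
  update n u f k with k ≟ n
  ... | yes refl = u
  ... | no  _    = f k

  update-same : ∀ n u f → update n u f n ≡ u
  update-same n u f rewrite ≟-diag (refl {x = n}) = refl

  update-other : ∀ {n u f k} → k ≢ n → update n u f k ≡ f k
  update-other {n} {k = k} k≢n with k ≟ n
  ... | yes k≡n = contradiction k≡n k≢n
  ... | no  _   = refl

  update-agreesFrom : ∀ n u f → AgreesFrom (suc n) (update n u f) f
  update-agreesFrom n u f k n<k = update-other (λ k≡n → <-irrefl (sym k≡n) n<k)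

  agreesFrom-update : ∀ {n f g} → AgreesFrom (suc n) f g → AgreesFrom n f (update n (f n) g)
  agreesFrom-update {n} {f} {g} agree k n≤k with m≤n⇒m<n∨m≡n n≤k
  ... | inj₁ n<k  = trans (agree k n<k) (sym (update-agreesFrom n (f n) g k n<k))
  ... | inj₂ refl = sym (update-same n (f n) g)

module _ (Γ : BranchingDiagram) where
  open BranchingDiagram Γ
  open Sequences (λ n → Fin (size n))

  Edge : (n : ℕ) → Fin (size n) → Fin (size (suc n)) → Set
  Edge n u w = edge n u w ≡ true

  module _ (m : ℕ) (u : Fin (size m)) (k : ℕ) {w : Fin (size (suc k + m))} where

    private
      term : Fin (size (k + m)) → ℕ
      term x = d Γ m u k x * (if edge (k + m) x w then 1 else 0)

      term-edge : ∀ {x} → Edge (k + m) x w → term x ≡ d Γ m u k x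
      term-edge = *-indicator-true (d Γ m u k _)

    d-pred≤ : ∀ {x} → Edge (k + m) x w → d Γ m u k x ≤ d Γ m u (suc k) w
    d-pred≤ {x} x↗w = subst (_≤ d Γ m u (suc k) w) (term-edge x↗w) (term≤sum-tabulate term x)

    d-two-preds : ∀ {x y} → Edge (k + m) x w → Edge (k + m) y w → x ≢ y →
                  d Γ m u k x + d Γ m u k y ≤ d Γ m u (suc k) w
    d-two-preds x↗w y↗w x≢y =
      subst₂ (λ a b → a + b ≤ d Γ m u (suc k) w) (term-edge x↗w) (term-edge y↗w)
        (two-terms≤sum-tabulate term x≢y)

    d-unique-pred : ∀ {x} → Edge (k + m) x w → (∀ y → Edge (k + m) y w → y ≡ x) →
                    d Γ m u (suc k) w ≡ d Γ m u k x
    d-unique-pred {x} x↗w unique = trans (sum-tabulate-single term x off-x) (term-edge x↗w)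
      where
      off-x : ∀ y → y ≢ x → term y ≡ 0
      off-x y y≢x = *-indicator-false (d Γ m u k y) (Bool.¬-not (y≢x ∘ unique y))

  d-root-positive : (∅ : Fin (size 0)) (k : ℕ) (v : Fin (size (k + 0))) → 1 ≤ d Γ 0 ∅ k v
  d-root-positive ∅ zero    v with ∅ Fin.≟ v
  ... | yes _   = ≤-refl
  ... | no  ∅≢v = contradiction (Fin-singleton size-0 ∅ v) ∅≢v
  d-root-positive ∅ (suc k) v =
    ≤-trans (d-root-positive ∅ k (proj₁ (hasPred (k + 0) v)))
            (d-pred≤ 0 ∅ k (proj₂ (hasPred (k + 0) v)))

  Sequence : Set
  Sequence = (k : ℕ) → Fin (size k)

  IsChainFrom : ℕ → Sequence → Set
  IsChainFrom n f = ∀ k → n ≤ k → Edge k (f k) (f (suc k))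

  Extension : ℕ → Sequence → Set
  Extension n f = Σ[ p ∈ Path Γ ] AgreesFrom n (vert Γ p) f

  isChainFrom-update : ∀ {n f u} → IsChainFrom (suc n) f → Edge n u (f (suc n)) →
                       IsChainFrom n (update n u f)
  isChainFrom-update {n} {f} {u} chain u↗ k n≤k with m≤n⇒m<n∨m≡n n≤k
  ... | inj₁ n<k  = subst₂ (Edge k) (sym (update-agreesFrom n u f k n<k))
                      (sym (update-agreesFrom n u f (suc k) (m≤n⇒m≤1+n n<k))) (chain k n<k)
  ... | inj₂ refl = subst₂ (Edge n) (sym (update-same n u f))
                      (sym (update-agreesFrom n u f (suc n) ≤-refl)) u↗

  extension-lift : ∀ {n f u} → Extension n (update n u f) → Extension (suc n) f
  extension-lift {n} {f} {u} (p , agree) = p , λ k n<k →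
    trans (agree k (<⇒≤ n<k)) (update-agreesFrom n u f k n<k)

  extend : ∀ n f → IsChainFrom n f → Extension n f
  extend zero    f chain = (f , λ k → chain k z≤n) , λ _ _ → refl
  extend (suc n) f chain with hasPred n (f (suc n))
  ... | u , u↗ = extension-lift (extend n (update n u f) (isChainFrom-update chain u↗))

  extensions : ∀ n f → IsChainFrom n f → List (Extension n f)
  extensions-via : ∀ n f → IsChainFrom (suc n) f → Fin (size n) → List (Extension (suc n) f)
  extensions zero    f chain = [ extend zero f chain ]
  extensions (suc n) f chain = concatMap (extensions-via n f chain) (allFin (size n))
  extensions-via n f chain u with edge n u (f (suc n)) Bool.≟ true
  ... | yes u↗ = map extension-lift (extensions n (update n u f) (isChainFrom-update chain u↗))
  ... | no  _  = []

  SamePath : Path Γ → Path Γ → Set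
  SamePath p q = ∀ k → vert Γ p k ≡ vert Γ q k

  extensions-complete : ∀ n f chain (p : Path Γ) → AgreesFrom n (vert Γ p) f →
                        Any (SamePath p ∘ proj₁) (extensions n f chain)
  extensions-via-complete : ∀ n f chain (p : Path Γ) → AgreesFrom (suc n) (vert Γ p) f →
                            Any (SamePath p ∘ proj₁) (extensions-via n f chain (vert Γ p n))
  extensions-complete zero    f chain p agree = here λ k → agree k z≤n
  extensions-complete (suc n) f chain p agree =
    Any.concatMap⁺ _ (lose (∈-allFin (vert Γ p n)) (extensions-via-complete n f chain p agree))
  extensions-via-complete n f chain p agree with edge n (vert Γ p n) (f (suc n)) Bool.≟ true
  ... | yes u↗ = Any.map⁺ (extensions-complete n _ _ p (agreesFrom-update agree))
  ... | no ¬u↗ =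
    contradiction (subst (Edge n (vert Γ p n)) (agree (suc n) ≤-refl) (proj₂ p n)) ¬u↗

  module _ (t : Path Γ) where

    private
      T : Sequence
      T = vert Γ t

      t-isChainFrom : ∀ n → IsChainFrom n T
      t-isChainFrom n k _ = proj₂ t k

    UniquePredAt : ℕ → Set
    UniquePredAt n = ∀ x → Edge n x (T (suc n)) → x ≡ T n

    uniquePred⇒dFinite : EventuallyUniquePred Γ t → ∀ m u → dFinite Γ m u t
    uniquePred⇒dFinite (N , unique) m u = stationary⇒hasFiniteLimit _ N λ k N≤k →
      d-unique-pred m u k (proj₂ t (k + m)) (unique (k + m) (≤-trans N≤k (m≤m+n k m)))

    dFinite⇒uniquePred : (∅ : Fin (size 0)) → dFinite Γ 0 ∅ t → EventuallyUniquePred Γ t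
    -- dFinite Γ 0 places the n-th vertex at level n + 0, which is not definitionally n.
    dFinite⇒uniquePred ∅ (L , N , limit) =
      N , λ n N≤n → subst UniquePredAt (+-identityʳ n) (unique n N≤n)
      where
      unique : ∀ n → N ≤ n → UniquePredAt (n + 0)
      unique n N≤n x x↗ with x Fin.≟ T (n + 0)
      ... | yes x≡vₙ = x≡vₙ
      ... | no  x≢vₙ = contradiction L+1≤L (m+1+n≰m L)
        where
        open ≤-Reasoning
        L+1≤L : L + 1 ≤ L
        L+1≤L = begin
          L + 1                               ≤⟨ +-monoʳ-≤ L (d-root-positive ∅ n x) ⟩
          L + d Γ 0 ∅ n x                     ≡⟨ cong (_+ d Γ 0 ∅ n x) (limit n N≤n) ⟨
          d Γ 0 ∅ n (T (n + 0)) + d Γ 0 ∅ n x ≤⟨ d-two-preds 0 ∅ n (proj₂ t (n + 0)) x↗ (x≢vₙ ∘ sym) ⟩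
          d Γ 0 ∅ (suc n) (T (suc n + 0))     ≡⟨ limit (suc n) (m≤n⇒m≤1+n N≤n) ⟩
          L                                   ∎

    Cofinal : Set
    Cofinal = Σ[ q ∈ Path Γ ] EventuallyEq Γ q t

    cofinal-commonBound : (qs : List Cofinal) →
                          ∃[ B ] All (λ q → AgreesFrom B (vert Γ (proj₁ q)) T) qs
    cofinal-commonBound [] = 0 , []
    cofinal-commonBound ((q , N , agree) ∷ qs) with cofinal-commonBound qs
    ... | B , agrees = N ⊔ B , agreesFrom-mono (m≤m⊔n N B) agree
                                 ∷ All.map (agreesFrom-mono (m≤n⊔m N B)) agrees

    finitelyManyCofinal⇒uniquePred : FinitelyManyCofinal Γ t → EventuallyUniquePred Γ t
    finitelyManyCofinal⇒uniquePred (qs , complete) with cofinal-commonBound qs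
    ... | B , agrees = B , unique
      where
      unique : ∀ n → B ≤ n → UniquePredAt n
      unique n B≤n x x↗ = begin
        x                  ≡⟨ update-same n x T ⟨
        update n x T n     ≡⟨ proj₂ detour n ≤-refl ⟨
        vert Γ p n         ≡⟨ p-agrees n B≤n ⟩
        T n                ∎
        where
        open ≡-Reasoning
        detour : Extension n (update n x T)
        detour = extend n (update n x T) (isChainFrom-update (t-isChainFrom (suc n)) x↗)
        p : Path Γ
        p = proj₁ detour
        p-cofinal : EventuallyEq Γ p t
        p-cofinal = suc n , proj₂ (extension-lift detour)
        p-agrees : AgreesFrom B (vert Γ p) T
        p-agrees = All.lookupWith (λ q-agrees same k B≤k → trans (same k) (q-agrees k B≤k))
                     agrees (complete p p-cofinal)

    uniquePred-agreeDownwards : ∀ {N} → (∀ n → N ≤ n → UniquePredAt n) → (p : Path Γ) →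
                                ∀ j n → N ≤ n → vert Γ p (j + n) ≡ T (j + n) → vert Γ p n ≡ T n
    uniquePred-agreeDownwards unique p zero    n N≤n agree = agree
    uniquePred-agreeDownwards unique p (suc j) n N≤n agree =
      uniquePred-agreeDownwards unique p j n N≤n
        (unique (j + n) (≤-trans N≤n (m≤n+m n j)) (vert Γ p (j + n))
          (subst (Edge (j + n) (vert Γ p (j + n))) agree (proj₂ p (j + n))))

    uniquePred⇒finitelyManyCofinal : EventuallyUniquePred Γ t → FinitelyManyCofinal Γ t
    uniquePred⇒finitelyManyCofinal (N , unique) =
      map toCofinal (extensions N T (t-isChainFrom N)) , λ p p-cofinal →
        Any.map⁺ (extensions-complete N T (t-isChainFrom N) p (agreesFrom-N p p-cofinal))
      where
      toCofinal : Extension N T → Cofinal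
      toCofinal (q , agree) = q , N , agree
      agreesFrom-N : ∀ p → EventuallyEq Γ p t → AgreesFrom N (vert Γ p) T
      agreesFrom-N p (M , agree) n N≤n =
        uniquePred-agreeDownwards unique p M n N≤n (agree (M + n) (m≤m+n M n))

lemma4p1 : (Γ : BranchingDiagram) (t : Path Γ) →
  let open BranchingDiagram Γ
      ∅ = subst Fin (sym size-0) zero
  in (EventuallyUniquePred Γ t ⇔ dFinite Γ 0 ∅ t)
     × (EventuallyUniquePred Γ t ⇔ (∀ (m : ℕ) (u : Fin (size m)) → dFinite Γ m u t))
     × (EventuallyUniquePred Γ t ⇔ FinitelyManyCofinal Γ t)
lemma4p1 Γ t =
    mk⇔ (λ i → uniquePred⇒dFinite Γ t i 0 ∅) (dFinite⇒uniquePred Γ t ∅)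
  , mk⇔ (uniquePred⇒dFinite Γ t) (λ iii → dFinite⇒uniquePred Γ t ∅ (iii 0 ∅))
  , mk⇔ (uniquePred⇒finitelyManyCofinal Γ t) (finitelyManyCofinal⇒uniquePred Γ t)
  where
  open BranchingDiagram Γ
  ∅ : Fin (size 0)
  ∅ = subst Fin (sym size-0) zero
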